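{- Let $k\geq 1$. Fix an edge decomposition of $Q_5$ into $20$ copies of $P_4$, given as a coloring $c:E(Q_5)\to\{1,\ldots,20\}$ in which each color class is the edge set of a path with $4$ edges. Identify the vertices of $Q_3\Box C_{4k}$ with pairs $(u,i)$, $u\in\{0,1\}^3$, $i\in\mathbb Z_{4k}$, and define $\theta(u,i)=u\,\gamma(i \bmod 4)\in\{0,1\}^5$ (concatenation), where $\gamma(0)=00$, $\gamma(1)=10$, $\gamma(2)=11$, $\gamma(3)=01$. Then $\theta$ maps every edge of $Q_3\Box C_{4k}$ to an edge of $Q_5$, so $c'(\langle x,y\rangle)=c(\langle\theta(x),\theta(y)\rangle)$ defines a coloring of $E(Q_3\Box C_{4k})$. For every $i\in\{1,\ldots,20\}$, the set of edges of $Q_3\Box C_{4k}$ with $c'$-color $i$ is a set of vertex-disjoint paths of length $4$. Consequently, $P_4$ divides $Q_3\Box C_{4m}$ for all $m\geq 1$.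
   Context: $Q_n$ is the $n$-dimensional hypercube with vertex set $\{0,1\}^n$, two vertices adjacent iff they differ in exactly one coordinate. $C_m$ is the cycle with $m$ edges (vertices $\mathbb Z_m$, $i$ adjacent to $i\pm1$), and $\Box$ is the Cartesian product of graphs. $P_4$ is the path with $4$ edges. If $H$ is isomorphic to a subgraph of $G$, $H$ divides $G$ if there exist embeddings $\theta_1,\ldots,\theta_r$ of $H$ into $G$ such that $\{E(\theta_1(H)),\ldots,E(\theta_r(H))\}$ is a partition of $E(G)$. -}

module Defs where

open import Data.Nat using (ℕ; zero; suc; _+_; _*_; _≤_)
open import Data.Nat.DivMod using (_%_)
open import Data.Bool using (Bool; true; false)
open import Data.Fin using (Fin; toℕ; inject₁)
  renaming (zero to fzero; suc to fsuc)
open import Data.Vec using (Vec; []; _∷_; _++_)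
open import Data.Product using (Σ; ∃; ∃-syntax; _×_; _,_)
open import Data.Sum using (_⊎_)
open import Relation.Binary.PropositionalEquality using (_≡_; _≢_)
open import Relation.Nullary using (¬_)
open import Function.Definitions using (Injective)
open import Function.Bundles using (_⇔_)

record Graph : Set₁ where
  field
    V   : Set
    Adj : V → V → Set
open Graph public

hamming : ∀ {n} → Vec Bool n → Vec Bool n → ℕ
hamming [] [] = 0
hamming (true ∷ u) (true ∷ v) = hamming u v
hamming (false ∷ u) (false ∷ v) = hamming u v
hamming (true ∷ u) (false ∷ v) = suc (hamming u v)
hamming (false ∷ u) (true ∷ v) = suc (hamming u v)

Q : ℕ → Graph
Q n = record { V = Vec Bool n ; Adj = λ u v → hamming u v ≡ 1 }

CSucc : (m : ℕ) → Fin m → Fin m → Set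
CSucc m i j = (suc (toℕ i) ≡ toℕ j) ⊎ (suc (toℕ i) ≡ m × toℕ j ≡ 0)

C : ℕ → Graph
C m = record { V = Fin m ; Adj = λ i j → CSucc m i j ⊎ CSucc m j i }

_□_ : Graph → Graph → Graph
G □ H = record
  { V   = V G × V H
  ; Adj = λ { (u , i) (v , j) → (Adj G u v × i ≡ j) ⊎ (u ≡ v × Adj H i j) } }

record P4Emb (G : Graph) : Set where
  field
    vx  : Fin 5 → V G
    inj : Injective _≡_ _≡_ vx
    adj : (j : Fin 4) → Adj G (vx (inject₁ j)) (vx (fsuc j))
open P4Emb public

EdgeOf : ∀ {G} → P4Emb G → V G → V G → Set
EdgeOf P x y = ∃[ j ] ((x ≡ vx P (inject₁ j) × y ≡ vx P (fsuc j))
                       ⊎ (y ≡ vx P (inject₁ j) × x ≡ vx P (fsuc j)))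

-- An edge colouring of G with colours in Fin r, given on ordered pairs
-- and symmetric on edges (values on non-adjacent pairs are irrelevant).
Coloring : Graph → ℕ → Set
Coloring G r = V G → V G → Fin r

IsEdgeColoring : ∀ {G r} → Coloring G r → Set
IsEdgeColoring {G} c = ∀ x y → Adj G x y → c x y ≡ c y x

IsP4Decomposition : ∀ {G r} → Coloring G r → Set
IsP4Decomposition {G} {r} c =
  IsEdgeColoring {G} c ×
  ((i : Fin r) → Σ (P4Emb G) λ P →
     ∀ x y → Adj G x y → (c x y ≡ i ⇔ EdgeOf P x y))

ClassIsDisjointP4s : ∀ {G r} → Coloring G r → Fin r → Set
ClassIsDisjointP4s {G} c i =
  Σ ℕ λ s → Σ (Fin s → P4Emb G) λ Ps →
    (∀ a b → a ≢ b → ∀ p q → vx (Ps a) p ≢ vx (Ps b) q) ×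
    (∀ x y → Adj G x y → (c x y ≡ i ⇔ (∃[ a ] EdgeOf (Ps a) x y)))

P4Divides : Graph → Set
P4Divides G =
  Σ ℕ λ r → Σ (Fin r → P4Emb G) λ θs →
    (∀ x y → Adj G x y → ∃[ a ] EdgeOf (θs a) x y) ×
    (∀ x y a b → EdgeOf (θs a) x y → EdgeOf (θs b) x y → a ≡ b)

γ : ℕ → Vec Bool 2
γ 0 = false ∷ false ∷ []
γ 1 = true ∷ false ∷ []
γ 2 = true ∷ true ∷ []
γ 3 = false ∷ true ∷ []
γ _ = false ∷ false ∷ []   -- never used (argument is always < 4)

θ : (m : ℕ) → V (Q 3 □ C m) → V (Q 5)
θ m (u , i) = u ++ γ (toℕ i % 4)

pullback : ∀ {r} (m : ℕ) → Coloring (Q 5) r → Coloring (Q 3 □ C m) r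
pullback m c x y = c (θ m x) (θ m y)

-- Since
-- γ runs around the 4-cycle Q₂ and 4 divides the cycle length, θ is a K-sheeted
-- covering map of graphs (K = k): it is a homomorphism (θ-hom), and it is
-- injective on the neighbourhood of each vertex (unique-edge-lift).  Hence a path
-- P of Q₅ has exactly K lifts, one per sheet: vertex j of P is lifted to position
-- 4 (a + level j) + rⱼ of the cycle, where rⱼ is the residue coded by the last two
-- bits of vertex j and the level counts wrap-arounds of that residue.  These
-- lifts are vertex-disjoint (sheet-unique) and every edge of G over an edge of P
-- lies on one of them (lift-covers), while their edges map to edges of P
-- (lift-projects).  Consequently the colour class i of c' = c ∘ θ consists of the
-- K disjoint lifts of the i-th path of c (colour-classes), and the lifts of the
-- paths of any P₄-division of Q₅ divide G (division-lifts).  The last part of the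
-- theorem then follows from the explicit division of Q₅ into 20 paths given in
-- the paper, which is checked by exhaustive search (P4-divides-Q₅).
module Submission where

open import Defs
open import Data.Nat using (ℕ; zero; suc; _+_; _*_; _/_; _%_; _<_; _≤_; _≡ᵇ_; z≤n; s≤s; NonZero)
import Data.Nat as ℕ
open import Data.Nat.Properties using (+-suc; +-assoc; +-comm; *-comm; *-suc; +-cancelʳ-≡; *-cancelˡ-≡; ≤-trans; ≤-reflexive; +-monoʳ-<; *-monoʳ-≤; m≤n⇒m<n∨m≡n)
open import Data.Nat.DivMod using (m%n<n; m≡m%n+[m/n]*n; [m+kn]%n≡m%n; [m+n]%n≡m%n; m<n⇒m%n≡m; m%n%n≡m%n; %-distribˡ-+; n%n≡0; m∣n⇒o%n%m≡o%m; m<n*o⇒m/o<n)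
open import Data.Nat.Divisibility using (_∣_; divides)
open import Data.Nat.Tactic.RingSolver using (solve-∀)
open import Data.Bool using (Bool; true; false)
import Data.Bool.Properties as Bool
open import Data.Fin using (Fin; toℕ; fromℕ<; inject₁; remQuot; combine) renaming (zero to fzero; suc to fsuc)
open import Data.Fin.Properties using (all?; any?; toℕ-fromℕ<; toℕ-injective; toℕ<n; remQuot-combine; combine-remQuot) renaming (_≟_ to _≟ᶠ_)
open import Data.Vec using (Vec; []; _∷_; _∷ʳ_; _++_; lookup; take; drop)
open import Data.Vec.Properties using (≡-dec; ++-injectiveˡ; ++-injectiveʳ; take++drop≡id)
open import Data.Product using (∃-syntax; _×_; _,_; proj₁; proj₂; uncurry)
open import Data.Sum using (_⊎_; inj₁; inj₂)
open import Data.Empty using (⊥-elim)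
open import Function using (_∘_)
open import Function.Bundles using (_⇔_; mk⇔; Equivalence)
open import Relation.Binary.PropositionalEquality using (_≡_; refl; sym; trans; cong; cong₂; subst; module ≡-Reasoning)
open import Relation.Nullary using (Dec; ¬_)
open import Relation.Nullary.Decidable using (map′; from-yes; _×-dec_; _⊎-dec_; _→-dec_)
open import Relation.Unary using (Decidable)

-- {x , y} and {s , t} are the same unordered pair.  Unfolding Defs,
-- EdgeOf E x y is ∃[ j ] SameEnds x y (vx E (inject₁ j)) (vx E (fsuc j)).
SameEnds : {A : Set} → A → A → A → A → Set
SameEnds x y s t = (x ≡ s × y ≡ t) ⊎ (y ≡ s × x ≡ t)

sameEnds-trans : {A : Set} {x y s t s' t' : A} →
  SameEnds x y s t → SameEnds x y s' t' → SameEnds s t s' t'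
sameEnds-trans (inj₁ (refl , refl)) (inj₁ (refl , refl)) = inj₁ (refl , refl)
sameEnds-trans (inj₁ (refl , refl)) (inj₂ (refl , refl)) = inj₂ (refl , refl)
sameEnds-trans (inj₂ (refl , refl)) (inj₁ (refl , refl)) = inj₂ (refl , refl)
sameEnds-trans (inj₂ (refl , refl)) (inj₂ (refl , refl)) = inj₁ (refl , refl)

edge-end : ∀ {G} (E : P4Emb G) {x y} → EdgeOf E x y → ∃[ k ] x ≡ vx E k
edge-end E (j , inj₁ (x≡ , _)) = inject₁ j , x≡
edge-end E (j , inj₂ (_ , x≡)) = fsuc j , x≡

EdgeOf-map : ∀ {G H} {E : P4Emb G} {E' : P4Emb H} (f : V G → V H) →
  (∀ k → f (vx E k) ≡ vx E' k) → ∀ {x y} → EdgeOf E x y → EdgeOf E' (f x) (f y)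
EdgeOf-map f f-E {x} {y} (j , inj₁ (refl , refl)) = j , inj₁ (f-E (inject₁ j) , f-E (fsuc j))
EdgeOf-map f f-E {x} {y} (j , inj₂ (refl , refl)) = j , inj₂ (f-E (inject₁ j) , f-E (fsuc j))

Word : ℕ → Set
Word n = Vec Bool n

_≟ʷ_ : ∀ {n} (u v : Word n) → Dec (u ≡ v)
_≟ʷ_ = ≡-dec Bool._≟_

sameEnds? : ∀ {n} (x y s t : Word n) → Dec (SameEnds x y s t)
sameEnds? x y s t = ((x ≟ʷ s) ×-dec (y ≟ʷ t)) ⊎-dec ((y ≟ʷ s) ×-dec (x ≟ʷ t))

∀-word? : ∀ {n p} {P : Word n → Set p} → Decidable P → Dec (∀ v → P v)
∀-word? {zero}  P? = map′ (λ p → λ { [] → p }) (λ p → p []) (P? [])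
∀-word? {suc n} P? =
  map′ (λ (p₁ , p₀) → λ { (true ∷ v) → p₁ v ; (false ∷ v) → p₀ v })
       (λ p → p ∘ (true ∷_) , p ∘ (false ∷_))
       (∀-word? (P? ∘ (true ∷_)) ×-dec ∀-word? (P? ∘ (false ∷_)))

hamming-++ : ∀ {n m} (u u' : Word n) (w w' : Word m) →
  hamming (u ++ w) (u' ++ w') ≡ hamming u u' + hamming w w'
hamming-++ []          []           w w' = refl
hamming-++ (true ∷ u)  (true ∷ u')  w w' = hamming-++ u u' w w'
hamming-++ (false ∷ u) (false ∷ u') w w' = hamming-++ u u' w w'
hamming-++ (true ∷ u)  (false ∷ u') w w' = cong suc (hamming-++ u u' w w')
hamming-++ (false ∷ u) (true ∷ u')  w w' = cong suc (hamming-++ u u' w w')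

hamming-refl : ∀ {n} (u : Word n) → hamming u u ≡ 0
hamming-refl []          = refl
hamming-refl (true ∷ u)  = hamming-refl u
hamming-refl (false ∷ u) = hamming-refl u

hamming-sym : ∀ {n} (u v : Word n) → hamming u v ≡ hamming v u
hamming-sym []          []          = refl
hamming-sym (true ∷ u)  (true ∷ v)  = hamming-sym u v
hamming-sym (false ∷ u) (false ∷ v) = hamming-sym u v
hamming-sym (true ∷ u)  (false ∷ v) = cong suc (hamming-sym u v)
hamming-sym (false ∷ u) (true ∷ v)  = cong suc (hamming-sym u v)

hamming≡0⇒≡ : ∀ {n} (u v : Word n) → hamming u v ≡ 0 → u ≡ v
hamming≡0⇒≡ []          []          _ = refl
hamming≡0⇒≡ (true ∷ u)  (true ∷ v)  e = cong (true ∷_) (hamming≡0⇒≡ u v e)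
hamming≡0⇒≡ (false ∷ u) (false ∷ v) e = cong (false ∷_) (hamming≡0⇒≡ u v e)

hamming-++≡1 : ∀ {n m} (u u' : Word n) (w w' : Word m) → hamming (u ++ w) (u' ++ w') ≡ 1 →
  (hamming u u' ≡ 1 × w ≡ w') ⊎ (u ≡ u' × hamming w w' ≡ 1)
hamming-++≡1 u u' w w' e = split (hamming u u') (hamming w w') refl refl (trans (sym (hamming-++ u u' w w')) e)
  where
  split : ∀ a b → hamming u u' ≡ a → hamming w w' ≡ b → a + b ≡ 1 →
    (hamming u u' ≡ 1 × w ≡ w') ⊎ (u ≡ u' × hamming w w' ≡ 1)
  split 0 1 du dw _ = inj₂ (hamming≡0⇒≡ u u' du , dw)
  split 1 0 du dw _ = inj₁ (du , hamming≡0⇒≡ w w' dw)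

next : ℕ → ℕ
next r = suc r % 4

ρ : Word 2 → ℕ
ρ (false ∷ false ∷ []) = 0
ρ (true  ∷ false ∷ []) = 1
ρ (true  ∷ true  ∷ []) = 2
ρ (false ∷ true  ∷ []) = 3

ρ<4 : ∀ w → ρ w < 4
ρ<4 (false ∷ false ∷ []) = s≤s z≤n
ρ<4 (true  ∷ false ∷ []) = s≤s (s≤s z≤n)
ρ<4 (true  ∷ true  ∷ []) = s≤s (s≤s (s≤s z≤n))
ρ<4 (false ∷ true  ∷ []) = s≤s (s≤s (s≤s (s≤s z≤n)))

γ-ρ : ∀ w → γ (ρ w) ≡ w
γ-ρ (false ∷ false ∷ []) = refl
γ-ρ (true  ∷ false ∷ []) = refl
γ-ρ (true  ∷ true  ∷ []) = refl
γ-ρ (false ∷ true  ∷ []) = refl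

ρ-γ : ∀ r → r < 4 → ρ (γ r) ≡ r
ρ-γ 0 _ = refl
ρ-γ 1 _ = refl
ρ-γ 2 _ = refl
ρ-γ 3 _ = refl
ρ-γ (suc (suc (suc (suc _)))) (s≤s (s≤s (s≤s (s≤s ()))))

γ-next : ∀ r → r < 4 → hamming (γ r) (γ (next r)) ≡ 1
γ-next 0 _ = refl
γ-next 1 _ = refl
γ-next 2 _ = refl
γ-next 3 _ = refl
γ-next (suc (suc (suc (suc _)))) (s≤s (s≤s (s≤s (s≤s ()))))

gray-step : ∀ w w' → hamming w w' ≡ 1 → ρ w' ≡ next (ρ w) ⊎ ρ w ≡ next (ρ w')
gray-step = from-yes (∀-word? λ w → ∀-word? λ w' →
  (hamming w w' ℕ.≟ 1) →-dec ((ρ w' ℕ.≟ next (ρ w)) ⊎-dec (ρ w ℕ.≟ next (ρ w'))))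

next-no-fixpoint : ∀ r → r < 4 → ¬ r ≡ next r
next-no-fixpoint 0 _ ()
next-no-fixpoint 1 _ ()
next-no-fixpoint 2 _ ()
next-no-fixpoint 3 _ ()
next-no-fixpoint (suc (suc (suc (suc _)))) (s≤s (s≤s (s≤s (s≤s ()))))

next²-no-fixpoint : ∀ r → r < 4 → ¬ r ≡ next (next r)
next²-no-fixpoint 0 _ ()
next²-no-fixpoint 1 _ ()
next²-no-fixpoint 2 _ ()
next²-no-fixpoint 3 _ ()
next²-no-fixpoint (suc (suc (suc (suc _)))) (s≤s (s≤s (s≤s (s≤s ()))))

%-absorbˡ : ∀ x y d .{{_ : NonZero d}} → (x % d + y) % d ≡ (x + y) % d
%-absorbˡ x y d = begin
  (x % d + y) % d           ≡⟨ %-distribˡ-+ (x % d) y d ⟩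
  (x % d % d + y % d) % d   ≡⟨ cong (λ z → (z + y % d) % d) (m%n%n≡m%n x d) ⟩
  (x % d + y % d) % d       ≡⟨ %-distribˡ-+ x y d ⟨
  (x + y) % d               ∎
  where open ≡-Reasoning

suc-% : ∀ x d .{{_ : NonZero d}} → suc x % d ≡ suc (x % d) % d
suc-% x d = begin
  suc x % d           ≡⟨ cong (_% d) (+-comm 1 x) ⟩
  (x + 1) % d         ≡⟨ %-absorbˡ x 1 d ⟨
  (x % d + 1) % d     ≡⟨ cong (_% d) (+-comm (x % d) 1) ⟩
  suc (x % d) % d     ∎
  where open ≡-Reasoning

[4y+r]%4 : ∀ y r → r < 4 → (4 * y + r) % 4 ≡ r
[4y+r]%4 y r r<4 = begin
  (4 * y + r) % 4   ≡⟨ cong (_% 4) (trans (+-comm (4 * y) r) (cong (r +_) (*-comm 4 y))) ⟩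
  (r + y * 4) % 4   ≡⟨ [m+kn]%n≡m%n r y 4 ⟩
  r % 4             ≡⟨ m<n⇒m%n≡m r<4 ⟩
  r                 ∎
  where open ≡-Reasoning

module Cover (k' : ℕ) where

  K : ℕ
  K = suc k'

  n : ℕ
  n = 4 * K

  G : Graph
  G = Q 3 □ C n

  4∣n : 4 ∣ n
  4∣n = divides K (*-comm 4 K)

  block-% : ∀ y r → r < 4 → (4 * y + r) % n ≡ 4 * (y % K) + r
  block-% y r r<4 = begin
    (4 * y + r) % n                          ≡⟨ cong (λ z → (4 * z + r) % n) (m≡m%n+[m/n]*n y K) ⟩
    (4 * (y % K + (y / K) * K) + r) % n      ≡⟨ cong (_% n) (regroup (y % K) (y / K) K r) ⟩
    (4 * (y % K) + r + (y / K) * n) % n      ≡⟨ [m+kn]%n≡m%n (4 * (y % K) + r) (y / K) n ⟩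
    (4 * (y % K) + r) % n                    ≡⟨ m<n⇒m%n≡m in-range ⟩
    4 * (y % K) + r                          ∎
    where
    open ≡-Reasoning
    regroup : ∀ a b c r → 4 * (a + b * c) + r ≡ 4 * a + r + b * (4 * c)
    regroup = solve-∀
    in-range : 4 * (y % K) + r < n
    in-range = ≤-trans (+-monoʳ-< (4 * (y % K)) r<4)
      (≤-trans (≤-reflexive (trans (+-comm (4 * (y % K)) 4) (sym (*-suc 4 (y % K)))))
               (*-monoʳ-≤ 4 (m%n<n y K)))

  -- Adding l blocks is a bijection of ℤ_K, inverted by adding l * k' ≡ -l blocks.
  unshift : ℕ → ℕ → ℕ
  unshift l q = (q + l * k') % K

  +l*K : ∀ x l → x + l + l * k' ≡ x + l * K
  +l*K x l = trans (+-assoc x l (l * k')) (cong (x +_) (sym (*-suc l k')))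

  unshift-shift : ∀ l a → a < K → unshift l ((a + l) % K) ≡ a
  unshift-shift l a a<K = begin
    ((a + l) % K + l * k') % K   ≡⟨ %-absorbˡ (a + l) (l * k') K ⟩
    (a + l + l * k') % K         ≡⟨ cong (_% K) (+l*K a l) ⟩
    (a + l * K) % K              ≡⟨ [m+kn]%n≡m%n a l K ⟩
    a % K                        ≡⟨ m<n⇒m%n≡m a<K ⟩
    a                            ∎
    where open ≡-Reasoning

  shift-unshift : ∀ l q → q < K → (unshift l q + l) % K ≡ q
  shift-unshift l q q<K = begin
    ((q + l * k') % K + l) % K   ≡⟨ %-absorbˡ (q + l * k') l K ⟩
    (q + l * k' + l) % K         ≡⟨ cong (_% K) (trans (+-assoc' q (l * k') l) (+l*K q l)) ⟩
    (q + l * K) % K              ≡⟨ [m+kn]%n≡m%n q l K ⟩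
    q % K                        ≡⟨ m<n⇒m%n≡m q<K ⟩
    q                            ∎
    where
    open ≡-Reasoning
    +-assoc' : ∀ a b c → a + b + c ≡ a + c + b
    +-assoc' = solve-∀

  cyc : ℕ → Fin n
  cyc N = fromℕ< (m%n<n N n)

  toℕ-cyc : ∀ N → toℕ (cyc N) ≡ N % n
  toℕ-cyc N = toℕ-fromℕ< (m%n<n N n)

  cyc-≡ : ∀ N M → N % n ≡ M % n → cyc N ≡ cyc M
  cyc-≡ N M e = toℕ-injective (trans (toℕ-cyc N) (trans e (sym (toℕ-cyc M))))

  residue : Fin n → ℕ
  residue t = toℕ t % 4

  residue<4 : ∀ t → residue t < 4
  residue<4 t = m%n<n (toℕ t) 4

  -- As 4 divides n, reducing a position mod n keeps its residue mod 4.
  residue-cyc : ∀ N → residue (cyc N) ≡ N % 4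
  residue-cyc N = trans (cong (_% 4) (toℕ-cyc N)) (m∣n⇒o%n%m≡o%m 4 n N 4∣n)

  CSucc⇒suc% : ∀ {t s} → CSucc n t s → toℕ s ≡ suc (toℕ t) % n
  CSucc⇒suc% {t} {s} (inj₁ e)       = sym (trans (cong (_% n) e) (m<n⇒m%n≡m (toℕ<n s)))
  CSucc⇒suc% {t} {s} (inj₂ (e , s≡0)) = trans s≡0 (sym (trans (cong (_% n) e) (n%n≡0 n)))

  cyc-CSucc : ∀ N → CSucc n (cyc N) (cyc (suc N))
  cyc-CSucc N with m≤n⇒m<n∨m≡n (m%n<n N n)
  ... | inj₁ 1+N%n<n = inj₁ (sym (begin
    toℕ (cyc (suc N))    ≡⟨ toℕ-cyc (suc N) ⟩
    suc N % n            ≡⟨ suc-% N n ⟩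
    suc (N % n) % n      ≡⟨ m<n⇒m%n≡m 1+N%n<n ⟩
    suc (N % n)          ≡⟨ cong suc (toℕ-cyc N) ⟨
    suc (toℕ (cyc N))    ∎))
    where open ≡-Reasoning
  ... | inj₂ 1+N%n≡n = inj₂ (trans (cong suc (toℕ-cyc N)) 1+N%n≡n ,
    trans (toℕ-cyc (suc N)) (trans (suc-% N n) (trans (cong (_% n) 1+N%n≡n) (n%n≡0 n))))

  CSucc-residue : ∀ {t s} → CSucc n t s → residue s ≡ next (residue t)
  CSucc-residue {t} c = trans (cong (_% 4) (CSucc⇒suc% c))
    (trans (m∣n⇒o%n%m≡o%m 4 n (suc (toℕ t)) 4∣n) (suc-% (toℕ t) 4))

  CSucc-functional : ∀ {t s s'} → CSucc n t s → CSucc n t s' → s ≡ s'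
  CSucc-functional c c' = toℕ-injective (trans (CSucc⇒suc% c) (sym (CSucc⇒suc% c')))

  -- x ↦ (x + 1) mod n is injective on [0, n): adding n - 1 = k' + 3K undoes it.
  suc%-injective : ∀ {X Y} → X < n → Y < n → suc X % n ≡ suc Y % n → X ≡ Y
  suc%-injective {X} {Y} X<n Y<n e = trans (sym (undo X X<n)) (trans (cong (λ z → (z + (k' + 3 * K)) % n) e) (undo Y Y<n))
    where
    undo : ∀ Z → Z < n → (suc Z % n + (k' + 3 * K)) % n ≡ Z
    undo Z Z<n = trans (%-absorbˡ (suc Z) (k' + 3 * K) n)
      (trans (cong (_% n) (sym (+-suc Z (k' + 3 * K)))) (trans ([m+n]%n≡m%n Z n) (m<n⇒m%n≡m Z<n)))

  CSucc-injective : ∀ {s s' t} → CSucc n s t → CSucc n s' t → s ≡ s'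
  CSucc-injective {s} {s'} c c' =
    toℕ-injective (suc%-injective (toℕ<n s) (toℕ<n s') (trans (sym (CSucc⇒suc% c)) (CSucc⇒suc% c')))

  Near : Fin n → Fin n → Set
  Near t s = t ≡ s ⊎ Adj (C n) t s

  -- Since 4 ∣ n, a vertex and its two neighbours have distinct residues mod 4.
  near-by-residue : ∀ {t s s'} → Near t s → Near t s' → residue s ≡ residue s' → s ≡ s'
  near-by-residue (inj₁ refl) (inj₁ refl) _ = refl
  near-by-residue {t} (inj₁ refl) (inj₂ (inj₁ c)) e =
    ⊥-elim (next-no-fixpoint (residue t) (residue<4 t) (trans e (CSucc-residue c)))
  near-by-residue {s' = s'} (inj₁ refl) (inj₂ (inj₂ c)) e =
    ⊥-elim (next-no-fixpoint (residue s') (residue<4 s') (trans (sym e) (CSucc-residue c)))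
  near-by-residue {t} (inj₂ (inj₁ c)) (inj₁ refl) e =
    ⊥-elim (next-no-fixpoint (residue t) (residue<4 t) (trans (sym e) (CSucc-residue c)))
  near-by-residue {s = s} (inj₂ (inj₂ c)) (inj₁ refl) e =
    ⊥-elim (next-no-fixpoint (residue s) (residue<4 s) (trans e (CSucc-residue c)))
  near-by-residue (inj₂ (inj₁ c)) (inj₂ (inj₁ c')) _ = CSucc-functional c c'
  near-by-residue (inj₂ (inj₂ c)) (inj₂ (inj₂ c')) _ = CSucc-injective c c'
  near-by-residue {t} (inj₂ (inj₁ c)) (inj₂ (inj₂ c')) e = ⊥-elim (next²-no-fixpoint (residue t) (residue<4 t)
    (trans (CSucc-residue c') (cong next (trans (sym e) (CSucc-residue c)))))
  near-by-residue {t} (inj₂ (inj₂ c)) (inj₂ (inj₁ c')) e = ⊥-elim (next²-no-fixpoint (residue t) (residue<4 t)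
    (trans (CSucc-residue c) (cong next (trans e (CSucc-residue c')))))

  γ-CSucc : ∀ {t s} → CSucc n t s → hamming (γ (residue t)) (γ (residue s)) ≡ 1
  γ-CSucc {t} c = trans (cong (hamming (γ (residue t)) ∘ γ) (CSucc-residue c)) (γ-next (residue t) (residue<4 t))

  -- θ is a graph homomorphism: a Q₃-edge keeps the Gray code, a cycle edge moves it.
  θ-hom : (x y : V G) → Adj G x y → Adj (Q 5) (θ n x) (θ n y)
  θ-hom (u , t) (v , .t) (inj₁ (h , refl)) =
    trans (hamming-++ u v (γ (residue t)) (γ (residue t))) (cong₂ _+_ h (hamming-refl (γ (residue t))))
  θ-hom (u , t) (.u , s) (inj₂ (refl , inj₁ c)) =
    trans (hamming-++ u u (γ (residue t)) (γ (residue s))) (cong₂ _+_ (hamming-refl u) (γ-CSucc c))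
  θ-hom (u , t) (.u , s) (inj₂ (refl , inj₂ c)) =
    trans (hamming-++ u u (γ (residue t)) (γ (residue s)))
          (cong₂ _+_ (hamming-refl u) (trans (hamming-sym (γ (residue t)) (γ (residue s))) (γ-CSucc c)))

  θ-split : ∀ {u t v s} → θ n (u , t) ≡ θ n (v , s) → u ≡ v × residue t ≡ residue s
  θ-split {u} {t} {v} {s} e = ++-injectiveˡ u v e ,
    trans (sym (ρ-γ (residue t) (residue<4 t))) (trans (cong ρ (++-injectiveʳ u v e)) (ρ-γ (residue s) (residue<4 s)))

  adj-sym : ∀ {x y} → Adj G x y → Adj G y x
  adj-sym {u , _} {v , _} (inj₁ (h , e))      = inj₁ (trans (hamming-sym v u) h , sym e)
  adj-sym                 (inj₂ (e , inj₁ c)) = inj₂ (sym e , inj₂ c)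
  adj-sym                 (inj₂ (e , inj₂ c)) = inj₂ (sym e , inj₁ c)

  near : ∀ {u t v s} → Adj G (u , t) (v , s) → Near t s
  near (inj₁ (_ , e)) = inj₁ e
  near (inj₂ (_ , a)) = inj₂ a

  unique-edge-lift : ∀ {x y y'} → Adj G x y → Adj G x y' → θ n y ≡ θ n y' → y ≡ y'
  unique-edge-lift {_ , _} {v , s} {v' , s'} h h' e =
    cong₂ _,_ (proj₁ split) (near-by-residue (near h) (near h') (proj₂ split))
    where
    split : v ≡ v' × residue s ≡ residue s'
    split = θ-split {v} {s} {v'} {s'} e

  -- A path of Q₅ is lifted by walking around the cycle: vertex j of the
  -- lift in sheet a sits at position 4 (a + level j) + rⱼ, where rⱼ is the residue of
  -- the Gray-code part of vertex j.  The level goes up when the residue wraps from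
  -- 3 to 0 and down when it wraps from 0 to 3; going down one level is going up
  -- k' = K - 1 levels, which is the same modulo K and avoids truncated subtraction.
  nextLevel : ℕ → ℕ → ℕ → ℕ
  nextLevel l 3 0 = suc l
  nextLevel l 0 3 = l + k'
  nextLevel l _ _ = l

  level : ∀ {m} → (Fin (suc m) → ℕ) → ℕ → Fin (suc m) → ℕ
  level rs l fzero = l
  level {suc m} rs l (fsuc j) = level (rs ∘ fsuc) (nextLevel l (rs fzero) (rs (fsuc fzero))) j

  level-step : ∀ {m} (rs : Fin (suc m) → ℕ) l (j : Fin m) →
    level rs l (fsuc j) ≡ nextLevel (level rs l (inject₁ j)) (rs (inject₁ j)) (rs (fsuc j))
  level-step rs l fzero    = refl
  level-step rs l (fsuc j) = level-step (rs ∘ fsuc) (nextLevel l (rs fzero) (rs (fsuc fzero))) j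

  at : ℕ → ℕ → ℕ
  at l r = 4 * l + r

  at-stay : ∀ a l r r' → r' ≡ r → at (a + nextLevel l r r') r' ≡ at (a + l) r
  at-stay a l 0 _ refl = refl
  at-stay a l 1 _ refl = refl
  at-stay a l 2 _ refl = refl
  at-stay a l 3 _ refl = refl
  at-stay a l (suc (suc (suc (suc _)))) _ refl = refl

  at-up : ∀ a l r r' → r < 4 → r' ≡ next r → at (a + nextLevel l r r') r' ≡ suc (at (a + l) r)
  at-up a l 0 _ _ refl = +-suc (4 * (a + l)) 0
  at-up a l 1 _ _ refl = +-suc (4 * (a + l)) 1
  at-up a l 2 _ _ refl = +-suc (4 * (a + l)) 2
  at-up a l 3 _ _ refl = wrap a l
    where
    wrap : ∀ a l → 4 * (a + suc l) + 0 ≡ suc (4 * (a + l) + 3)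
    wrap = solve-∀
  at-up a l (suc (suc (suc (suc _)))) _ (s≤s (s≤s (s≤s (s≤s ())))) _

  at-down : ∀ a l r r' → r' < 4 → r ≡ next r' → cyc (suc (at (a + nextLevel l r r') r')) ≡ cyc (at (a + l) r)
  at-down a l _ 0 _ refl = cong cyc (sym (+-suc (4 * (a + l)) 0))
  at-down a l _ 1 _ refl = cong cyc (sym (+-suc (4 * (a + l)) 1))
  at-down a l _ 2 _ refl = cong cyc (sym (+-suc (4 * (a + l)) 2))
  at-down a l _ 3 _ refl = cyc-≡ (suc (at (a + (l + k')) 3)) (4 * (a + l) + 0) (trans (cong (_% n) (wrap a l k')) ([m+n]%n≡m%n (4 * (a + l) + 0) n))
    where
    wrap : ∀ a l m → suc (4 * (a + (l + m)) + 3) ≡ 4 * (a + l) + 0 + 4 * suc m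
    wrap = solve-∀
  at-down a l _ (suc (suc (suc (suc _)))) (s≤s (s≤s (s≤s (s≤s ())))) _

  same-sheet : ∀ {a b} l r → a < K → b < K → r < 4 → cyc (at (a + l) r) ≡ cyc (at (b + l) r) → a ≡ b
  same-sheet {a} {b} l r a<K b<K r<4 e = begin
    a                            ≡⟨ unshift-shift l a a<K ⟨
    unshift l ((a + l) % K)      ≡⟨ cong (unshift l) blocks ⟩
    unshift l ((b + l) % K)      ≡⟨ unshift-shift l b b<K ⟩
    b                            ∎
    where
    open ≡-Reasoning
    blocks : (a + l) % K ≡ (b + l) % K
    blocks = *-cancelˡ-≡ ((a + l) % K) ((b + l) % K) 4 (+-cancelʳ-≡ r (4 * ((a + l) % K)) (4 * ((b + l) % K)) (begin
      4 * ((a + l) % K) + r   ≡⟨ block-% (a + l) r r<4 ⟨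
      at (a + l) r % n        ≡⟨ trans (sym (toℕ-cyc (at (a + l) r))) (trans (cong toℕ e) (toℕ-cyc (at (b + l) r))) ⟩
      at (b + l) r % n        ≡⟨ block-% (b + l) r r<4 ⟩
      4 * ((b + l) % K) + r   ∎))

  sheet-of : ∀ l r t → residue t ≡ r → ∃[ a ] t ≡ cyc (at (toℕ a + l) r)
  sheet-of l r t t≡r = a , toℕ-injective (sym (begin
    toℕ (cyc (at (toℕ a + l) r))            ≡⟨ toℕ-cyc (at (toℕ a + l) r) ⟩
    at (toℕ a + l) r % n                    ≡⟨ block-% (toℕ a + l) r r<4 ⟩
    4 * ((toℕ a + l) % K) + r               ≡⟨ cong (λ z → 4 * ((z + l) % K) + r) (toℕ-fromℕ< (m%n<n (q + l * k') K)) ⟩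
    4 * ((unshift l q + l) % K) + r         ≡⟨ cong (λ z → 4 * z + r) (shift-unshift l q q<K) ⟩
    4 * q + r                               ≡⟨ cong (4 * q +_) (sym t≡r) ⟩
    4 * q + toℕ t % 4                       ≡⟨ trans (+-comm (4 * q) _) (cong (toℕ t % 4 +_) (*-comm 4 q)) ⟩
    toℕ t % 4 + q * 4                       ≡⟨ m≡m%n+[m/n]*n (toℕ t) 4 ⟨
    toℕ t                                   ∎))
    where
    open ≡-Reasoning
    q : ℕ
    q = toℕ t / 4
    q<K : q < K
    q<K = m<n*o⇒m/o<n (subst (toℕ t <_) (*-comm 4 K) (toℕ<n t))
    r<4 : r < 4
    r<4 = subst (_< 4) t≡r (residue<4 t)
    a : Fin K
    a = fromℕ< (m%n<n (q + l * k') K)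

  module Lift (P : P4Emb (Q 5)) where

    p : Fin 5 → Word 5
    p = vx P

    r : Fin 5 → ℕ
    r j = ρ (drop 3 (p j))

    pos : Fin K → Fin 5 → ℕ
    pos a j = at (toℕ a + level r 0 j) (r j)

    lift : Fin K → Fin 5 → V G
    lift a j = take 3 (p j) , cyc (pos a j)

    residue-lift : ∀ a j → residue (cyc (pos a j)) ≡ r j
    residue-lift a j = trans (residue-cyc (pos a j)) ([4y+r]%4 (toℕ a + level r 0 j) (r j) (ρ<4 (drop 3 (p j))))

    θ-lift : ∀ a j → θ n (lift a j) ≡ p j
    θ-lift a j = begin
      take 3 (p j) ++ γ (residue (cyc (pos a j)))   ≡⟨ cong (λ z → take 3 (p j) ++ γ z) (residue-lift a j) ⟩
      take 3 (p j) ++ γ (r j)                       ≡⟨ cong (take 3 (p j) ++_) (γ-ρ (drop 3 (p j))) ⟩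
      take 3 (p j) ++ drop 3 (p j)                  ≡⟨ take++drop≡id 3 (p j) ⟩
      p j                                           ∎
      where open ≡-Reasoning

    -- An edge of P changes either the Q₃ part (the lift stays at its position on
    -- the cycle) or the Gray-code part (the lift moves one step along the cycle).
    lift-adj : ∀ a (j : Fin 4) → Adj G (lift a (inject₁ j)) (lift a (fsuc j))
    lift-adj a j = by-kind (hamming-++≡1 (take 3 (p j₀)) (take 3 (p j₁)) (drop 3 (p j₀)) (drop 3 (p j₁)) edge)
      where
      j₀ j₁ : Fin 5
      j₀ = inject₁ j
      j₁ = fsuc j
      l : ℕ
      l = level r 0 j₀
      edge : hamming (take 3 (p j₀) ++ drop 3 (p j₀)) (take 3 (p j₁) ++ drop 3 (p j₁)) ≡ 1
      edge = trans (cong₂ hamming (take++drop≡id 3 (p j₀)) (take++drop≡id 3 (p j₁))) (adj P j)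
      pos-next : pos a j₁ ≡ at (toℕ a + nextLevel l (r j₀) (r j₁)) (r j₁)
      pos-next = cong (λ z → at (toℕ a + z) (r j₁)) (level-step r 0 j)
      by-kind : (hamming (take 3 (p j₀)) (take 3 (p j₁)) ≡ 1 × drop 3 (p j₀) ≡ drop 3 (p j₁))
              ⊎ (take 3 (p j₀) ≡ take 3 (p j₁) × hamming (drop 3 (p j₀)) (drop 3 (p j₁)) ≡ 1) →
              Adj G (lift a j₀) (lift a j₁)
      by-kind (inj₁ (h , w≡w')) =
        inj₁ (h , cong cyc (sym (trans pos-next (at-stay (toℕ a) l (r j₀) (r j₁) (cong ρ (sym w≡w'))))))
      by-kind (inj₂ (u≡u' , h)) with gray-step (drop 3 (p j₀)) (drop 3 (p j₁)) h
      ... | inj₁ up = inj₂ (u≡u' , inj₁ (subst (CSucc n (cyc (pos a j₀)))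
              (cong cyc (sym (trans pos-next (at-up (toℕ a) l (r j₀) (r j₁) (ρ<4 (drop 3 (p j₀))) up))))
              (cyc-CSucc (pos a j₀))))
      ... | inj₂ down = inj₂ (u≡u' , inj₂ (subst (CSucc n (cyc (pos a j₁)))
              (trans (cong (cyc ∘ suc) pos-next) (at-down (toℕ a) l (r j₀) (r j₁) (ρ<4 (drop 3 (p j₁))) down))
              (cyc-CSucc (pos a j₁))))

    liftEmb : Fin K → P4Emb G
    liftEmb a = record
      { vx  = lift a
      ; inj = λ {i} {j} e → inj P (trans (sym (θ-lift a i)) (trans (cong (θ n) e) (θ-lift a j)))
      ; adj = lift-adj a }

    -- Distinct lifts are vertex-disjoint: a shared vertex determines the sheet.
    sheet-unique : ∀ {a b i j} → lift a i ≡ lift b j → a ≡ b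
    sheet-unique {a} {b} {i} {j} e with inj P (trans (sym (θ-lift a i)) (trans (cong (θ n) e) (θ-lift b j)))
    ... | refl = toℕ-injective (same-sheet (level r 0 i) (r i) (toℕ<n a) (toℕ<n b) (ρ<4 (drop 3 (p i))) (cong proj₂ e))

    lift-onto : ∀ {x} j → θ n x ≡ p j → ∃[ a ] x ≡ lift a j
    lift-onto {u , t} j e = proj₁ sheet , cong₂ _,_ (proj₁ split) (proj₂ sheet)
      where
      split : u ≡ take 3 (p j) × residue t ≡ residue (cyc (pos fzero j))
      split = θ-split {u} {t} {take 3 (p j)} {cyc (pos fzero j)} (trans e (sym (θ-lift fzero j)))
      sheet : ∃[ a ] t ≡ cyc (pos a j)
      sheet = sheet-of (level r 0 j) (r j) t (trans (proj₂ split) (residue-lift fzero j))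

    lift-edge : ∀ {x y} j → Adj G x y → θ n x ≡ p (inject₁ j) → θ n y ≡ p (fsuc j) →
      ∃[ a ] (x ≡ lift a (inject₁ j) × y ≡ lift a (fsuc j))
    lift-edge {x} {y} j h θx θy = a , x≡ ,
      unique-edge-lift (subst (λ z → Adj G z y) x≡ h) (lift-adj a j) (trans θy (sym (θ-lift a (fsuc j))))
      where
      a : Fin K
      a = proj₁ (lift-onto {x} (inject₁ j) θx)
      x≡ : x ≡ lift a (inject₁ j)
      x≡ = proj₂ (lift-onto {x} (inject₁ j) θx)

    lift-covers : ∀ {x y} → Adj G x y → EdgeOf P (θ n x) (θ n y) → ∃[ a ] EdgeOf (liftEmb a) x y
    lift-covers h (j , inj₁ (θx , θy)) =
      let a , x≡ , y≡ = lift-edge j h θx θy in a , j , inj₁ (x≡ , y≡)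
    lift-covers h (j , inj₂ (θy , θx)) =
      let a , y≡ , x≡ = lift-edge j (adj-sym h) θy θx in a , j , inj₂ (y≡ , x≡)

    lift-projects : ∀ a {x y} → EdgeOf (liftEmb a) x y → EdgeOf P (θ n x) (θ n y)
    lift-projects a = EdgeOf-map {E = liftEmb a} {E' = P} (θ n) (θ-lift a)

  -- Part (ii): a colour class of the pulled-back colouring is the set of edges
  -- over one path of Q₅, i.e. the edges of its K vertex-disjoint lifts.
  colour-classes : (c : Coloring (Q 5) 20) → IsP4Decomposition {Q 5} c →
    (i : Fin 20) → ClassIsDisjointP4s {G} (pullback n c) i
  colour-classes c (_ , classes) i =
    K , liftEmb , (λ a b a≢b _ _ e → a≢b (sheet-unique e)) ,
    λ x y h → mk⇔ (λ cxy≡i → lift-covers h (Equivalence.to (class x y h) cxy≡i))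
                  (λ (a , e) → Equivalence.from (class x y h) (lift-projects a e))
    where
    open Lift (proj₁ (classes i))
    class : ∀ x y → Adj G x y → (c (θ n x) (θ n y) ≡ i ⇔ EdgeOf (proj₁ (classes i)) (θ n x) (θ n y))
    class x y h = proj₂ (classes i) (θ n x) (θ n y) (θ-hom x y h)

  division-lifts : P4Divides (Q 5) → P4Divides G
  division-lifts (r , Ps , cover , unique) = r * K , Θ ∘ remQuot K , covered , disjoint
    where
    Θ : Fin r × Fin K → P4Emb G
    Θ (i , a) = Lift.liftEmb (Ps i) a

    -- Lifts sharing an edge project to paths sharing an edge, and then share a vertex.
    same-lift : ∀ {x y} ia ia' → EdgeOf (Θ ia) x y → EdgeOf (Θ ia') x y → ia ≡ ia'
    same-lift (i , a) (i' , a') e e' with unique _ _ i i' (Lift.lift-projects (Ps i) a e) (Lift.lift-projects (Ps i') a' e')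
    ... | refl = cong (i ,_) (Lift.sheet-unique (Ps i)
                   (trans (sym (proj₂ (edge-end (Θ (i , a)) e))) (proj₂ (edge-end (Θ (i , a')) e'))))

    covered : ∀ x y → Adj G x y → ∃[ z ] EdgeOf (Θ (remQuot K z)) x y
    covered x y h =
      let i , e = cover (θ n x) (θ n y) (θ-hom x y h)
          a , e' = Lift.lift-covers (Ps i) h e
      in combine i a , subst (λ ia → EdgeOf (Θ ia) x y) (sym (remQuot-combine i a)) e'

    disjoint : ∀ x y z z' → EdgeOf (Θ (remQuot K z)) x y → EdgeOf (Θ (remQuot K z')) x y → z ≡ z'
    disjoint x y z z' e e' = begin
      z                                  ≡⟨ combine-remQuot {r} K z ⟨
      uncurry combine (remQuot {r} K z)  ≡⟨ cong (uncurry combine) (same-lift {x} {y} (remQuot K z) (remQuot K z') e e') ⟩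
      uncurry combine (remQuot {r} K z') ≡⟨ combine-remQuot {r} K z' ⟩
      z'                                 ∎
      where open ≡-Reasoning

-- `bits n d` reads the last n decimal digits of d as a 0/1-word: bits 5 00101 is 0 0 1 0 1.
bits : (n : ℕ) → ℕ → Word n
bits zero    d = []
bits (suc n) d = bits n (d / 10) ∷ʳ (d % 10 ≡ᵇ 1)

-- The 20 paths of the paper's decomposition of Q₅, each listed by its 5 vertices;
-- the facts below are verified by exhaustive search.
pathTable : Vec (Vec ℕ 5) 20
pathTable =
  (00001 ∷ 00000 ∷ 10000 ∷ 10001 ∷ 11001 ∷ []) ∷
  (10010 ∷ 00010 ∷ 00000 ∷ 01000 ∷ 01010 ∷ []) ∷
  (00000 ∷ 00100 ∷ 00101 ∷ 00111 ∷ 00110 ∷ []) ∷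
  (11100 ∷ 10100 ∷ 10000 ∷ 11000 ∷ 11001 ∷ []) ∷
  (10000 ∷ 10010 ∷ 10110 ∷ 11110 ∷ 11111 ∷ []) ∷
  (11100 ∷ 01100 ∷ 01000 ∷ 11000 ∷ 11010 ∷ []) ∷
  (01000 ∷ 01001 ∷ 01011 ∷ 00011 ∷ 00010 ∷ []) ∷
  (11000 ∷ 11100 ∷ 11101 ∷ 01101 ∷ 01001 ∷ []) ∷
  (00010 ∷ 00110 ∷ 00100 ∷ 10100 ∷ 10110 ∷ []) ∷
  (00100 ∷ 01100 ∷ 01101 ∷ 01111 ∷ 01011 ∷ []) ∷
  (10100 ∷ 10101 ∷ 10001 ∷ 00001 ∷ 00011 ∷ []) ∷
  (01100 ∷ 01110 ∷ 00110 ∷ 10110 ∷ 10111 ∷ []) ∷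
  (11100 ∷ 11110 ∷ 01110 ∷ 01010 ∷ 00010 ∷ []) ∷
  (10001 ∷ 10011 ∷ 10010 ∷ 11010 ∷ 11110 ∷ []) ∷
  (01011 ∷ 01010 ∷ 11010 ∷ 11011 ∷ 10011 ∷ []) ∷
  (01110 ∷ 01111 ∷ 11111 ∷ 11011 ∷ 01011 ∷ []) ∷
  (00101 ∷ 00001 ∷ 01001 ∷ 11001 ∷ 11011 ∷ []) ∷
  (11001 ∷ 11101 ∷ 10101 ∷ 00101 ∷ 01101 ∷ []) ∷
  (10101 ∷ 10111 ∷ 10011 ∷ 00011 ∷ 00111 ∷ []) ∷
  (11101 ∷ 11111 ∷ 10111 ∷ 00111 ∷ 01111 ∷ []) ∷
  []

path : Fin 20 → Fin 5 → Word 5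
path i j = bits 5 (lookup (lookup pathTable i) j)

path-embeds : ∀ i → (∀ p q → path i p ≡ path i q → p ≡ q)
                  × (∀ j → Adj (Q 5) (path i (inject₁ j)) (path i (fsuc j)))
path-embeds = from-yes (all? λ i →
  (all? λ p → all? λ q → (path i p ≟ʷ path i q) →-dec (p ≟ᶠ q)) ×-dec
  (all? λ j → hamming (path i (inject₁ j)) (path i (fsuc j)) ℕ.≟ 1))

pathEmb : Fin 20 → P4Emb (Q 5)
pathEmb i = record
  { vx  = path i
  ; inj = λ {p} {q} → proj₁ (path-embeds i) p q
  ; adj = proj₂ (path-embeds i) }

paths-cover : ∀ x y → Adj (Q 5) x y → ∃[ i ] EdgeOf (pathEmb i) x y
paths-cover = from-yes (∀-word? λ x → ∀-word? λ y →
  (hamming x y ℕ.≟ 1) →-dec (any? λ i → any? λ j →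
     sameEnds? x y (path i (inject₁ j)) (path i (fsuc j))))

paths-edge-disjoint : ∀ i i' j j' →
  SameEnds (path i (inject₁ j)) (path i (fsuc j)) (path i' (inject₁ j')) (path i' (fsuc j')) → i ≡ i'
paths-edge-disjoint = from-yes (all? λ i → all? λ i' → all? λ j → all? λ j' →
  sameEnds? (path i (inject₁ j)) (path i (fsuc j)) (path i' (inject₁ j')) (path i' (fsuc j'))
    →-dec (i ≟ᶠ i'))

P4-divides-Q₅ : P4Divides (Q 5)
P4-divides-Q₅ = 20 , pathEmb , paths-cover ,
  λ { x y i i' (j , e) (j' , e') → paths-edge-disjoint i i' j j' (sameEnds-trans e e') }

lemma6 : (k : ℕ) → 1 ≤ k → (c : Coloring (Q 5) 20) → IsP4Decomposition {Q 5} c →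
    ((x y : V (Q 3 □ C (4 * k))) → Adj (Q 3 □ C (4 * k)) x y → Adj (Q 5) (θ (4 * k) x) (θ (4 * k) y))
    × ((i : Fin 20) → ClassIsDisjointP4s {Q 3 □ C (4 * k)} (pullback (4 * k) c) i)
    × ((m : ℕ) → 1 ≤ m → P4Divides (Q 3 □ C (4 * m)))
lemma6 (suc k') _ c decomposition = θ-hom , colour-classes c decomposition , Q₃□C₄ₘ-divisible
  where
  open Cover k'
  Q₃□C₄ₘ-divisible : (m : ℕ) → 1 ≤ m → P4Divides (Q 3 □ C (4 * m))
  Q₃□C₄ₘ-divisible (suc m') _ = Cover.division-lifts m' P4-divides-Q₅
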